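{- For all CoS formulae $\alpha$ and $\beta$ such that $\alpha=\beta$, there is a $\mathsf{Frege}$ derivation with premiss $\alpha$, conclusion $\beta$, length $O(n^3)$ and size $O(n^4)$, where $n=|\alpha|+|\beta|$.
   Context: CoS formulae are built from units $\mathsf f,\mathsf t$, atoms $a,\bar a,\dots$, formula variables $A,\bar A,\dots$ by $[\alpha\vee\beta]$ and $(\alpha\wedge\beta)$; the De Morgan dual $\bar\alpha$ exchanges $\vee/\wedge$, $\mathsf t/\mathsf f$ and negates atoms and variables. Size $|\alpha|$ = number of occurrences of units, atoms and variables. The equality $=$ is the smallest equivalence relation on formulae, closed under contexts ($\alpha=\beta$ implies $\xi\{\alpha\}=\xi\{\beta\}$ for every formula-with-one-hole $\xi$), containing commutativity and associativity of $\vee$ and $\wedge$, $[\alpha\vee\mathsf f]=\alpha$, $(\alpha\wedge\mathsf t)=\alpha$, $[\mathsf t\vee\mathsf t]=\mathsf t$ and $(\mathsf f\wedge\mathsf f)=\mathsf f$. $\mathsf{Frege}$: formulae over $\mathsf t,\mathsf f$, non-negated variables, $\vee,\wedge,\to,\neg$; axiom schemes $F_1: A\to(B\to(A\wedge B))$; $F_2:(A\wedge B)\to A$; $F_3:(A\wedge B)\to B$; $F_4:A\to(A\vee B)$; $F_5:B\to(A\vee B)$; $F_6:\neg\neg A\to A$; $F_7:A\to\neg\neg A$; $F_8:A\to(B\to A)$; $F_9:\neg A\to(A\to B)$; $F_{10}:(A\to(B\to C))\to((A\to B)\to(A\to C))$; $F_{11}:(A\to C)\to((B\to C)\to((A\vee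 B)\to C))$; $F_{12}:(A\to(B\to C))\to(B\to(A\to C))$; $F_{13}:(A\to B)\to(\neg B\to\neg A)$; $F_{14}:\mathsf f\to(A\wedge\neg A)$; $F_{15}:(A\wedge\neg A)\to\mathsf f$; $F_{16}:\mathsf t\to(A\vee\neg A)$; $F_{17}:(A\vee\neg A)\to\mathsf t$ (instances by substituting formulae), and modus ponens. A Frege derivation with given premisses is a sequence of formulae each of which is a premiss, an axiom instance, or follows by modus ponens from earlier ones; its length is the number of formulae, its size the number of occurrences of units and variables. Translation: CoS formulae are read as Frege formulae with atoms/variables as Frege variables and negated atoms/variables as $\neg$ of variables. -}

module Defs where

open import Data.Nat using (ℕ; zero; suc; _+_; _*_; _^_; _≤_)
open import Data.Bool using (Bool; true; false; not)
open import Data.List using (List; []; _∷_; length; map; reverse; _∷ʳ_)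
open import Data.Nat.ListAction using (sum)
open import Data.List.Membership.Propositional using (_∈_)
open import Data.Product using (Σ; _×_; _,_)
open import Data.Unit using (⊤)
open import Relation.Binary.PropositionalEquality using (_≡_)

-- CoS formulae
-- Atoms and formula variables are indexed by ℕ; the Bool is the polarity
-- (true = non-negated, false = negated: a vs ā, A vs Ā).

data CoS : Set where
  𝕗 𝕥  : CoS
  atom : Bool → ℕ → CoS
  var  : Bool → ℕ → CoS
  _∨_  : CoS → CoS → CoS
  _∧_  : CoS → CoS → CoS

dual : CoS → CoS
dual 𝕗 = 𝕥
dual 𝕥 = 𝕗
dual (atom b a) = atom (not b) a
dual (var b A) = var (not b) A
dual (α ∨ β) = dual α ∧ dual β
dual (α ∧ β) = dual α ∨ dual β

∣_∣ : CoS → ℕ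
∣ 𝕗 ∣ = 1
∣ 𝕥 ∣ = 1
∣ atom _ _ ∣ = 1
∣ var _ _ ∣ = 1
∣ α ∨ β ∣ = ∣ α ∣ + ∣ β ∣
∣ α ∧ β ∣ = ∣ α ∣ + ∣ β ∣

data Ctx : Set where
  □    : Ctx
  _∨ₗ_ : Ctx → CoS → Ctx
  _∨ᵣ_ : CoS → Ctx → Ctx
  _∧ₗ_ : Ctx → CoS → Ctx
  _∧ᵣ_ : CoS → Ctx → Ctx

_⟦_⟧ : Ctx → CoS → CoS
□ ⟦ α ⟧ = α
(ξ ∨ₗ β) ⟦ α ⟧ = (ξ ⟦ α ⟧) ∨ β
(β ∨ᵣ ξ) ⟦ α ⟧ = β ∨ (ξ ⟦ α ⟧)
(ξ ∧ₗ β) ⟦ α ⟧ = (ξ ⟦ α ⟧) ∧ β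
(β ∧ᵣ ξ) ⟦ α ⟧ = β ∧ (ξ ⟦ α ⟧)

data EqAx : CoS → CoS → Set where
  ∨-comm  : ∀ α β → EqAx (α ∨ β) (β ∨ α)
  ∧-comm  : ∀ α β → EqAx (α ∧ β) (β ∧ α)
  ∨-assoc : ∀ α β γ → EqAx ((α ∨ β) ∨ γ) (α ∨ (β ∨ γ))
  ∧-assoc : ∀ α β γ → EqAx ((α ∧ β) ∧ γ) (α ∧ (β ∧ γ))
  ∨-unit  : ∀ α → EqAx (α ∨ 𝕗) α
  ∧-unit  : ∀ α → EqAx (α ∧ 𝕥) α
  𝕥∨𝕥     : EqAx (𝕥 ∨ 𝕥) 𝕥
  𝕗∧𝕗     : EqAx (𝕗 ∧ 𝕗) 𝕗

data _≐_ : CoS → CoS → Set where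
  ax    : ∀ {α β} → EqAx α β → α ≐ β
  refl≐ : ∀ {α} → α ≐ α
  sym≐  : ∀ {α β} → α ≐ β → β ≐ α
  trans≐ : ∀ {α β γ} → α ≐ β → β ≐ γ → α ≐ γ
  ctx   : ∀ {α β} (ξ : Ctx) → α ≐ β → (ξ ⟦ α ⟧) ≐ (ξ ⟦ β ⟧)

data Fm : Set where
  ⊤ᶠ ⊥ᶠ : Fm
  v     : ℕ → Fm
  _∨ᶠ_ _∧ᶠ_ _⇒_ : Fm → Fm → Fm
  ¬ᶠ_   : Fm → Fm

size : Fm → ℕ
size ⊤ᶠ = 1
size ⊥ᶠ = 1
size (v _) = 1
size (φ ∨ᶠ ψ) = size φ + size ψ
size (φ ∧ᶠ ψ) = size φ + size ψ
size (φ ⇒ ψ) = size φ + size ψ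
size (¬ᶠ φ) = size φ

data Axiom : Fm → Set where
  F1  : ∀ A B → Axiom (A ⇒ (B ⇒ (A ∧ᶠ B)))
  F2  : ∀ A B → Axiom ((A ∧ᶠ B) ⇒ A)
  F3  : ∀ A B → Axiom ((A ∧ᶠ B) ⇒ B)
  F4  : ∀ A B → Axiom (A ⇒ (A ∨ᶠ B))
  F5  : ∀ A B → Axiom (B ⇒ (A ∨ᶠ B))
  F6  : ∀ A → Axiom ((¬ᶠ (¬ᶠ A)) ⇒ A)
  F7  : ∀ A → Axiom (A ⇒ (¬ᶠ (¬ᶠ A)))
  F8  : ∀ A B → Axiom (A ⇒ (B ⇒ A))
  F9  : ∀ A B → Axiom ((¬ᶠ A) ⇒ (A ⇒ B))
  F10 : ∀ A B C → Axiom ((A ⇒ (B ⇒ C)) ⇒ ((A ⇒ B) ⇒ (A ⇒ C)))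
  F11 : ∀ A B C → Axiom ((A ⇒ C) ⇒ ((B ⇒ C) ⇒ ((A ∨ᶠ B) ⇒ C)))
  F12 : ∀ A B C → Axiom ((A ⇒ (B ⇒ C)) ⇒ (B ⇒ (A ⇒ C)))
  F13 : ∀ A B → Axiom ((A ⇒ B) ⇒ ((¬ᶠ B) ⇒ (¬ᶠ A)))
  F14 : ∀ A → Axiom (⊥ᶠ ⇒ (A ∧ᶠ (¬ᶠ A)))
  F15 : ∀ A → Axiom ((A ∧ᶠ (¬ᶠ A)) ⇒ ⊥ᶠ)
  F16 : ∀ A → Axiom (⊤ᶠ ⇒ (A ∨ᶠ (¬ᶠ A)))
  F17 : ∀ A → Axiom ((A ∨ᶠ (¬ᶠ A)) ⇒ ⊤ᶠ)

data Justified (p : Fm) (earlier : List Fm) (φ : Fm) : Set where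
  premiss : φ ≡ p → Justified p earlier φ
  axiom   : Axiom φ → Justified p earlier φ
  mp      : ∀ ψ → ψ ∈ earlier → (ψ ⇒ φ) ∈ earlier → Justified p earlier φ

-- validity of a derivation given in REVERSE order (last line first)
ValidRev : Fm → List Fm → Set
ValidRev p [] = ⊤
ValidRev p (φ ∷ ds) = Justified p ds φ × ValidRev p ds

IsDerivation : Fm → List Fm → Set
IsDerivation p ds = ValidRev p (reverse ds)

record Derivation (p q : Fm) : Set where
  constructor deriv
  field
    before : List Fm
    valid  : IsDerivation p (before ∷ʳ q)

  lines : List Fm
  lines = before ∷ʳ q

  len : ℕ
  len = length lines

  dsize : ℕ
  dsize = sum (map size lines)

-- translation CoS → Frege. Atom a_i ↦ variable 2i, formula variable A_i ↦
-- variable 2i+1 (distinct Frege variables); negated ones get ¬.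

lit : Bool → Fm → Fm
lit true φ = φ
lit false φ = ¬ᶠ φ

tr : CoS → Fm
tr 𝕗 = ⊥ᶠ
tr 𝕥 = ⊤ᶠ
tr (atom b i) = lit b (v (2 * i))
tr (var b i) = lit b (v (suc (2 * i)))
tr (α ∨ β) = tr α ∨ᶠ tr β
tr (α ∧ β) = tr α ∧ᶠ tr β

module Submission where

open import Defs
open import Data.Nat using (ℕ; suc; _+_; _*_; _^_; _≤_; _≤ᵇ_; z≤n; s≤s)
open import Data.Nat.Properties
open import Data.Nat.Tactic.RingSolver using (solve-∀)
open import Data.Nat.ListAction using (sum)
open import Data.Bool using (Bool; true; false; T) renaming (_∨_ to _or_)
open import Data.Bool.Properties using () renaming (∨-assoc to or-assoc; ∨-comm to or-comm; ∨-identityʳ to or-identityʳ)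
open import Data.List using (List; []; _∷_; length; map; reverse; _∷ʳ_; _++_)
open import Data.List.Properties using (length-++; unfold-reverse; reverse-involutive; length-reverse; ++-assoc; ++-identityʳ)
open import Data.List.Relation.Unary.All as All using (All; []; _∷_)
open import Data.List.Relation.Unary.All.Properties using (++⁺)
open import Data.List.Relation.Unary.Any using (here)
open import Data.List.Membership.Propositional using (_∈_)
open import Data.List.Membership.Propositional.Properties using (∈-++⁺ˡ; ∈-++⁺ʳ)
open import Data.List.Relation.Binary.Permutation.Propositional using (↭-sym)
open import Data.List.Relation.Binary.Permutation.Propositional.Properties using (All-resp-↭; ↭-reverse)
open import Data.Product as Product using (Σ; _×_; _,_; proj₁; proj₂)
open import Data.Unit using (tt) renaming (⊤ to Unit)
open import Data.Empty using (⊥)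
open import Relation.Binary.PropositionalEquality

-- A derivation of α = β may be arbitrarily long, so instead of following it
-- we compare α and β through normal forms.
--   * Proof trees over F1–F17 and modus ponens are linearised into
--     derivations: a proof of p ⇒ q gives a derivation of q from p.
--   * Formula schemes bound the size of axiom instances; with them we derive
--     the Hilbert rules we need (identity, syllogism, cases, pairing, ...),
--     each with explicit bounds on the number and size of lines.
--   * Provable equivalence Equiv o ℓ A B is a congruence and validates the
--     CoS equations (commutativity, associativity, units, t ∨ t, f ∧ f).
--   * Normal forms flatten nested ∨/∧ into n-ary nodes; nf maps equal CoS
--     formulae to normal forms equal up to reordering of children (≈).
--   * tr α is equivalent to the embedding of nf α, and ≈-equal normal forms
--     have equivalent embeddings, both by proofs of length O(n²).
-- The theorem chains tr α ⇔ nf α ≈ nf β ⇔ tr β and linearises the result.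

data Proof : Fm → Set where
  byAxiom : ∀ {φ} → Axiom φ → Proof φ
  byMP    : ∀ {ψ φ} → Proof (ψ ⇒ φ) → Proof ψ → Proof φ

linearise : ∀ {φ} → Proof φ → List Fm
linearise (byAxiom {φ} _) = φ ∷ []
linearise (byMP {φ = φ} d e) = φ ∷ (linearise d ++ linearise e)

conclusion∈ : ∀ {φ} (d : Proof φ) → φ ∈ linearise d
conclusion∈ (byAxiom _) = here refl
conclusion∈ (byMP _ _) = here refl

conclusion-holds : ∀ {P : Fm → Set} {φ} (d : Proof φ) → All P (linearise d) → P φ
conclusion-holds (byAxiom _) (pφ ∷ _) = pφ
conclusion-holds (byMP _ _) (pφ ∷ _) = pφ

justified-++ : ∀ {p xs ys φ} → Justified p xs φ → Justified p (xs ++ ys) φ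
justified-++ (premiss e) = premiss e
justified-++ (axiom a) = axiom a
justified-++ (mp ψ i j) = mp ψ (∈-++⁺ˡ i) (∈-++⁺ˡ j)

validRev-++ : ∀ {p} xs {ys} → ValidRev p xs → ValidRev p ys → ValidRev p (xs ++ ys)
validRev-++ [] _ w = w
validRev-++ (φ ∷ xs) (j , rest) w = justified-++ j , validRev-++ xs rest w

linearise-valid : ∀ {p φ} (d : Proof φ) → ValidRev p (linearise d)
linearise-valid (byAxiom a) = axiom a , tt
linearise-valid (byMP {ψ} d e) =
  mp ψ (∈-++⁺ʳ (linearise d) (conclusion∈ e)) (∈-++⁺ˡ (conclusion∈ d)) ,
  validRev-++ (linearise d) (linearise-valid d) (linearise-valid e)

record Bounded (s ℓ : ℕ) (φ : Fm) : Set where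
  constructor bounded
  field
    tree   : Proof φ
    narrow : All (λ ψ → size ψ ≤ s) (linearise tree)
    short  : length (linearise tree) ≤ ℓ
open Bounded public

sum-sizes≤ : ∀ {s} xs → All (λ φ → size φ ≤ s) xs → sum (map size xs) ≤ length xs * s
sum-sizes≤ [] [] = z≤n
sum-sizes≤ (x ∷ xs) (px ∷ pxs) = +-mono-≤ px (sum-sizes≤ xs pxs)

derivation : ∀ {s ℓ p q} → size p ≤ s → Bounded s ℓ (p ⇒ q) →
  Σ (Derivation p q) λ D → (Derivation.len D ≤ 2 + ℓ) × (Derivation.dsize D ≤ (2 + ℓ) * s)
derivation {s} {ℓ} {p} {q} p≤s (bounded d d≤s d≤ℓ) = deriv (reverse R) valid , length≤ , dsize≤
  where
  R : List Fm
  R = linearise d ++ p ∷ []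
  L : List Fm
  L = q ∷ R
  lines≡ : reverse R ∷ʳ q ≡ reverse L
  lines≡ = sym (unfold-reverse q R)
  validL : ValidRev p L
  validL = mp p (∈-++⁺ʳ (linearise d) (here refl)) (∈-++⁺ˡ (conclusion∈ d)) ,
           validRev-++ (linearise d) (linearise-valid d) (premiss refl , tt)
  valid : ValidRev p (reverse (reverse R ∷ʳ q))
  valid = subst (ValidRev p) (sym (trans (cong reverse lines≡) (reverse-involutive L))) validL
  lengthL≤ : length L ≤ 2 + ℓ
  lengthL≤ = s≤s (subst (_≤ suc ℓ) (sym (trans (length-++ (linearise d)) (+-comm _ 1))) (s≤s d≤ℓ))
  length≤ : length (reverse R ∷ʳ q) ≤ 2 + ℓ
  length≤ = subst (_≤ 2 + ℓ) (sym (trans (cong length lines≡) (length-reverse L))) lengthL≤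
  q≤s : size q ≤ s
  q≤s = ≤-trans (m≤n+m (size q) (size p)) (conclusion-holds d d≤s)
  boundL : All (λ φ → size φ ≤ s) (reverse L)
  boundL = All-resp-↭ (↭-sym (↭-reverse L)) (q≤s ∷ ++⁺ d≤s (p≤s ∷ []))
  dsize≤ : sum (map size (reverse R ∷ʳ q)) ≤ (2 + ℓ) * s
  dsize≤ = subst (λ ls → sum (map size ls) ≤ (2 + ℓ) * s) (sym lines≡)
             (≤-trans (sum-sizes≤ (reverse L) boundL)
                      (*-monoˡ-≤ s (≤-trans (≤-reflexive (length-reverse L)) lengthL≤)))

-- Every axiom instance used
-- below is an instance of a scheme with at most K leaves, so its size is at
-- most K times a bound on the sizes of the instantiating formulae.

data Scheme : Set where
  X Y Z ⊤ˢ ⊥ˢ   : Scheme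
  _⇒ˢ_ _∨ˢ_ _∧ˢ_ : Scheme → Scheme → Scheme
  ¬ˢ_          : Scheme → Scheme

infixr 5 _⇒ˢ_
infix 7 _∨ˢ_ _∧ˢ_
infix 8 ¬ˢ_

instantiate : Scheme → Fm → Fm → Fm → Fm
instantiate X A B C = A
instantiate Y A B C = B
instantiate Z A B C = C
instantiate ⊤ˢ A B C = ⊤ᶠ
instantiate ⊥ˢ A B C = ⊥ᶠ
instantiate (s ⇒ˢ t) A B C = instantiate s A B C ⇒ instantiate t A B C
instantiate (s ∨ˢ t) A B C = instantiate s A B C ∨ᶠ instantiate t A B C
instantiate (s ∧ˢ t) A B C = instantiate s A B C ∧ᶠ instantiate t A B C
instantiate (¬ˢ t) A B C = ¬ᶠ instantiate t A B C

leaves : Scheme → ℕ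
leaves X = 1
leaves Y = 1
leaves Z = 1
leaves ⊤ˢ = 1
leaves ⊥ˢ = 1
leaves (s ⇒ˢ t) = leaves s + leaves t
leaves (s ∨ˢ t) = leaves s + leaves t
leaves (s ∧ˢ t) = leaves s + leaves t
leaves (¬ˢ t) = leaves t

size-pos : ∀ φ → 1 ≤ size φ
size-pos ⊤ᶠ = s≤s z≤n
size-pos ⊥ᶠ = s≤s z≤n
size-pos (v _) = s≤s z≤n
size-pos (φ ∨ᶠ ψ) = ≤-trans (size-pos φ) (m≤m+n _ _)
size-pos (φ ∧ᶠ ψ) = ≤-trans (size-pos φ) (m≤m+n _ _)
size-pos (φ ⇒ ψ) = ≤-trans (size-pos φ) (m≤m+n _ _)
size-pos (¬ᶠ φ) = size-pos φ

infix 4 _≼_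
_≼_ : Fm → ℕ → Set
A ≼ o = size A ≤ o

one-leaf : ∀ {n o} → n ≤ o → n ≤ 1 * o
one-leaf n≤o = ≤-trans n≤o (m≤m+n _ 0)

two-parts : ∀ s t {m n o} → m ≤ leaves s * o → n ≤ leaves t * o → m + n ≤ (leaves s + leaves t) * o
two-parts s t {o = o} m≤ n≤ = ≤-trans (+-mono-≤ m≤ n≤) (≤-reflexive (sym (*-distribʳ-+ o (leaves s) (leaves t))))

instance-size : ∀ t {A B C o} → A ≼ o → B ≼ o → C ≼ o → 1 ≤ o →
  size (instantiate t A B C) ≤ leaves t * o
instance-size X a b c u = one-leaf a
instance-size Y a b c u = one-leaf b
instance-size Z a b c u = one-leaf c
instance-size ⊤ˢ a b c u = one-leaf u
instance-size ⊥ˢ a b c u = one-leaf u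
instance-size (s ⇒ˢ t) a b c u = two-parts s t (instance-size s a b c u) (instance-size t a b c u)
instance-size (s ∨ˢ t) a b c u = two-parts s t (instance-size s a b c u) (instance-size t a b c u)
instance-size (s ∧ˢ t) a b c u = two-parts s t (instance-size s a b c u) (instance-size t a b c u)
instance-size (¬ˢ t) a b c u = instance-size t a b c u

-- Lines of the proofs below have size at most K · o, where o bounds the
-- formulae the proofs are about.
K : ℕ
K = 16

lit≤ : ∀ {m n} {_ : T (m ≤ᵇ n)} → m ≤ n
lit≤ {m} {n} {m≤ᵇn} = ≤ᵇ⇒≤ m n m≤ᵇn

Prf : ℕ → ℕ → Fm → Set
Prf o ℓ φ = Bounded (K * o) ℓ φ

axiom[_] : ∀ t {A B C o} {_ : T (leaves t ≤ᵇ K)} → Axiom (instantiate t A B C) →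
  A ≼ o → B ≼ o → C ≼ o → Prf o 1 (instantiate t A B C)
axiom[ t ] {A} {B} {C} {o} {t≤K} instance-of-t a b c =
  bounded (byAxiom instance-of-t) (size≤ ∷ []) ≤-refl
  where
  size≤ : size (instantiate t A B C) ≤ K * o
  size≤ = ≤-trans (instance-size t a b c (≤-trans (size-pos A) a)) (*-monoˡ-≤ o (≤ᵇ⇒≤ (leaves t) K t≤K))

infixl 5 _·_
_·_ : ∀ {s ℓ₁ ℓ₂ ψ φ} → Bounded s ℓ₁ (ψ ⇒ φ) → Bounded s ℓ₂ ψ → Bounded s (suc (ℓ₁ + ℓ₂)) φ
_·_ {s} {ψ = ψ} {φ} (bounded d d≤s d≤ℓ) (bounded e e≤s e≤ℓ) =
  bounded (byMP d e) (φ≤s ∷ ++⁺ d≤s e≤s)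
          (s≤s (≤-trans (≤-reflexive (length-++ (linearise d))) (+-mono-≤ d≤ℓ e≤ℓ)))
  where
  φ≤s : size φ ≤ s
  φ≤s = ≤-trans (m≤n+m (size φ) (size ψ)) (conclusion-holds d d≤s)

weaken : ∀ {s s' ℓ ℓ' φ} → s ≤ s' → ℓ ≤ ℓ' → Bounded s ℓ φ → Bounded s' ℓ' φ
weaken s≤s' ℓ≤ℓ' (bounded d d≤s d≤ℓ) = bounded d (All.map (λ φ≤s → ≤-trans φ≤s s≤s') d≤s) (≤-trans d≤ℓ ℓ≤ℓ')

weakenℓ : ∀ {s ℓ ℓ' φ} → ℓ ≤ ℓ' → Bounded s ℓ φ → Bounded s ℓ' φ
weakenℓ = weaken ≤-refl

∧-elimˡ : ∀ {o A B} → A ≼ o → B ≼ o → Prf o 1 ((A ∧ᶠ B) ⇒ A)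
∧-elimˡ {A = A} {B} a b = axiom[ (X ∧ˢ Y) ⇒ˢ X ] {A} {B} {B} (F2 A B) a b b

∧-elimʳ : ∀ {o A B} → A ≼ o → B ≼ o → Prf o 1 ((A ∧ᶠ B) ⇒ B)
∧-elimʳ {A = A} {B} a b = axiom[ (X ∧ˢ Y) ⇒ˢ Y ] {A} {B} {B} (F3 A B) a b b

∨-introˡ : ∀ {o A B} → A ≼ o → B ≼ o → Prf o 1 (A ⇒ (A ∨ᶠ B))
∨-introˡ {A = A} {B} a b = axiom[ X ⇒ˢ (X ∨ˢ Y) ] {A} {B} {B} (F4 A B) a b b

∨-introʳ : ∀ {o A B} → A ≼ o → B ≼ o → Prf o 1 (B ⇒ (A ∨ᶠ B))
∨-introʳ {A = A} {B} a b = axiom[ Y ⇒ˢ (X ∨ˢ Y) ] {A} {B} {B} (F5 A B) a b b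

⇒-refl : ∀ {o A} → A ≼ o → Prf o 5 (A ⇒ A)
⇒-refl {A = A} a =
  axiom[ (X ⇒ˢ (X ⇒ˢ X) ⇒ˢ X) ⇒ˢ (X ⇒ˢ X ⇒ˢ X) ⇒ˢ (X ⇒ˢ X) ] {A} {A} {A} (F10 A (A ⇒ A) A) a a a
  · axiom[ X ⇒ˢ (X ⇒ˢ X) ⇒ˢ X ] {A} {A} {A} (F8 A (A ⇒ A)) a a a
  · axiom[ X ⇒ˢ X ⇒ˢ X ] {A} {A} {A} (F8 A A) a a a

⇒-trans : ∀ {o A B C ℓ₁ ℓ₂} → A ≼ o → B ≼ o → C ≼ o →
  Prf o ℓ₁ (A ⇒ B) → Prf o ℓ₂ (B ⇒ C) → Prf o (ℓ₁ + ℓ₂ + 5) (A ⇒ C)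
⇒-trans {A = A} {B} {C} {ℓ₁} {ℓ₂} a b c ab bc =
  weakenℓ (≤-reflexive (count ℓ₁ ℓ₂))
    (axiom[ (X ⇒ˢ Y ⇒ˢ Z) ⇒ˢ (X ⇒ˢ Y) ⇒ˢ (X ⇒ˢ Z) ] {A} {B} {C} (F10 A B C) a b c
     · (axiom[ (Y ⇒ˢ Z) ⇒ˢ X ⇒ˢ (Y ⇒ˢ Z) ] {A} {B} {C} (F8 (B ⇒ C) A) a b c · bc)
     · ab)
  where
  count : ∀ x y → suc (suc (1 + suc (1 + y)) + x) ≡ x + y + 5
  count = solve-∀

∨-elim : ∀ {o A B C ℓ₁ ℓ₂} → A ≼ o → B ≼ o → C ≼ o →
  Prf o ℓ₁ (A ⇒ C) → Prf o ℓ₂ (B ⇒ C) → Prf o (ℓ₁ + ℓ₂ + 3) ((A ∨ᶠ B) ⇒ C)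
∨-elim {A = A} {B} {C} {ℓ₁} {ℓ₂} a b c ac bc =
  weakenℓ (≤-reflexive (count ℓ₁ ℓ₂))
    (axiom[ (X ⇒ˢ Z) ⇒ˢ (Y ⇒ˢ Z) ⇒ˢ ((X ∨ˢ Y) ⇒ˢ Z) ] {A} {B} {C} (F11 A B C) a b c · ac · bc)
  where
  count : ∀ x y → suc (suc (1 + x) + y) ≡ x + y + 3
  count = solve-∀

∧-intro : ∀ {o C A B ℓ₁ ℓ₂} → C ≼ o → A ≼ o → B ≼ o →
  Prf o ℓ₁ (C ⇒ A) → Prf o ℓ₂ (C ⇒ B) → Prf o (ℓ₁ + ℓ₂ + 9) (C ⇒ (A ∧ᶠ B))
∧-intro {C = C} {A} {B} {ℓ₁} {ℓ₂} c a b ca cb =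
  weakenℓ (≤-reflexive (count ℓ₁ ℓ₂))
    (axiom[ (Z ⇒ˢ Y ⇒ˢ (X ∧ˢ Y)) ⇒ˢ (Z ⇒ˢ Y) ⇒ˢ (Z ⇒ˢ (X ∧ˢ Y)) ] {A} {B} {C} (F10 C B (A ∧ᶠ B)) a b c
     · (axiom[ (Z ⇒ˢ X ⇒ˢ Y ⇒ˢ (X ∧ˢ Y)) ⇒ˢ (Z ⇒ˢ X) ⇒ˢ (Z ⇒ˢ Y ⇒ˢ (X ∧ˢ Y)) ] {A} {B} {C} (F10 C A (B ⇒ (A ∧ᶠ B))) a b c
        · (axiom[ (X ⇒ˢ Y ⇒ˢ (X ∧ˢ Y)) ⇒ˢ Z ⇒ˢ (X ⇒ˢ Y ⇒ˢ (X ∧ˢ Y)) ] {A} {B} {C} (F8 (A ⇒ (B ⇒ (A ∧ᶠ B))) C) a b c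
           · axiom[ X ⇒ˢ Y ⇒ˢ (X ∧ˢ Y) ] {A} {B} {C} (F1 A B) a b c)
        · ca)
     · cb)
  where
  count : ∀ x y → suc (suc (1 + suc (suc (1 + suc (1 + 1)) + x)) + y) ≡ x + y + 9
  count = solve-∀

-- ⊤, from F17 applied to (⊥ ⇒ ⊥) ∨ ¬(⊥ ⇒ ⊥), which holds by F4.
⊤-intro : ∀ {o} → 1 ≤ o → Prf o 9 ⊤ᶠ
⊤-intro u =
  axiom[ ((⊥ˢ ⇒ˢ ⊥ˢ) ∨ˢ ¬ˢ (⊥ˢ ⇒ˢ ⊥ˢ)) ⇒ˢ ⊤ˢ ] {⊤ᶠ} {⊤ᶠ} {⊤ᶠ} (F17 (⊥ᶠ ⇒ ⊥ᶠ)) u u u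
  · (axiom[ (⊥ˢ ⇒ˢ ⊥ˢ) ⇒ˢ ((⊥ˢ ⇒ˢ ⊥ˢ) ∨ˢ ¬ˢ (⊥ˢ ⇒ˢ ⊥ˢ)) ] {⊤ᶠ} {⊤ᶠ} {⊤ᶠ} (F4 (⊥ᶠ ⇒ ⊥ᶠ) (¬ᶠ (⊥ᶠ ⇒ ⊥ᶠ))) u u u
     · ⇒-refl u)

⇒⊤ : ∀ {o A} → A ≼ o → Prf o 11 (A ⇒ ⊤ᶠ)
⇒⊤ {A = A} a = axiom[ ⊤ˢ ⇒ˢ X ⇒ˢ ⊤ˢ ] {A} {A} {A} (F8 ⊤ᶠ A) a a a · ⊤-intro (≤-trans (size-pos A) a)

⊥⇒ : ∀ {o A} → A ≼ o → Prf o 7 (⊥ᶠ ⇒ A)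
⊥⇒ {A = A} a =
  axiom[ (⊥ˢ ⇒ˢ (X ∧ˢ ¬ˢ X) ⇒ˢ X) ⇒ˢ (⊥ˢ ⇒ˢ (X ∧ˢ ¬ˢ X)) ⇒ˢ (⊥ˢ ⇒ˢ X) ] {A} {A} {A} (F10 ⊥ᶠ (A ∧ᶠ (¬ᶠ A)) A) a a a
  · (axiom[ ((X ∧ˢ ¬ˢ X) ⇒ˢ X) ⇒ˢ ⊥ˢ ⇒ˢ ((X ∧ˢ ¬ˢ X) ⇒ˢ X) ] {A} {A} {A} (F8 ((A ∧ᶠ (¬ᶠ A)) ⇒ A) ⊥ᶠ) a a a
     · axiom[ (X ∧ˢ ¬ˢ X) ⇒ˢ X ] {A} {A} {A} (F2 A (¬ᶠ A)) a a a)
  · axiom[ ⊥ˢ ⇒ˢ (X ∧ˢ ¬ˢ X) ] {A} {A} {A} (F14 A) a a a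

⇒∧⊤ : ∀ {o A} → A ≼ o → Prf o 13 (A ⇒ (A ∧ᶠ ⊤ᶠ))
⇒∧⊤ {A = A} a =
  axiom[ (X ⇒ˢ ⊤ˢ ⇒ˢ (X ∧ˢ ⊤ˢ)) ⇒ˢ (⊤ˢ ⇒ˢ X ⇒ˢ (X ∧ˢ ⊤ˢ)) ] {A} {A} {A} (F12 A ⊤ᶠ (A ∧ᶠ ⊤ᶠ)) a a a
  · axiom[ X ⇒ˢ ⊤ˢ ⇒ˢ (X ∧ˢ ⊤ˢ) ] {A} {A} {A} (F1 A ⊤ᶠ) a a a
  · ⊤-intro (≤-trans (size-pos A) a)

data Conn : Set where
  disj conj : Conn

op : Conn → Fm → Fm → Fm
op disj = _∨ᶠ_
op conj = _∧ᶠ_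

unit : Conn → Fm
unit disj = ⊥ᶠ
unit conj = ⊤ᶠ

absorbing : Conn → Fm
absorbing disj = ⊤ᶠ
absorbing conj = ⊥ᶠ

size-op : ∀ k A B → size (op k A B) ≡ size A + size B
size-op disj A B = refl
size-op conj A B = refl

size-unit : ∀ k → size (unit k) ≡ 1
size-unit disj = refl
size-unit conj = refl

size-absorbing : ∀ k → size (absorbing k) ≡ 1
size-absorbing disj = refl
size-absorbing conj = refl

record Equiv (o ℓ : ℕ) (A B : Fm) : Set where
  constructor equiv
  field
    left≤  : A ≼ o
    right≤ : B ≼ o
    forth  : Prf o ℓ (A ⇒ B)
    back   : Prf o ℓ (B ⇒ A)
open Equiv public

equiv-refl : ∀ {o A} → A ≼ o → Equiv o 5 A A
equiv-refl a = equiv a a (⇒-refl a) (⇒-refl a)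

equiv-sym : ∀ {o ℓ A B} → Equiv o ℓ A B → Equiv o ℓ B A
equiv-sym (equiv a b ab ba) = equiv b a ba ab

equiv-trans : ∀ {o ℓ₁ ℓ₂ A B C} → Equiv o ℓ₁ A B → Equiv o ℓ₂ B C → Equiv o (ℓ₁ + ℓ₂ + 5) A C
equiv-trans {ℓ₁ = ℓ₁} {ℓ₂} (equiv a b ab ba) (equiv _ c bc cb) =
  equiv a c (⇒-trans a b c ab bc) (weakenℓ (≤-reflexive (cong (_+ 5) (+-comm ℓ₂ ℓ₁))) (⇒-trans c b a cb ba))

equiv-weaken : ∀ {o o' ℓ ℓ' A B} → o ≤ o' → ℓ ≤ ℓ' → Equiv o ℓ A B → Equiv o' ℓ' A B
equiv-weaken o≤o' ℓ≤ℓ' (equiv a b ab ba) =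
  equiv (≤-trans a o≤o') (≤-trans b o≤o') (weaken (*-monoʳ-≤ K o≤o') ℓ≤ℓ' ab) (weaken (*-monoʳ-≤ K o≤o') ℓ≤ℓ' ba)

infixl 1 _⟨≤_
_⟨≤_ : ∀ {o ℓ A B} → Equiv o ℓ A B → ∀ {ℓ'} → ℓ ≤ ℓ' → Equiv o ℓ' A B
e ⟨≤ ℓ≤ℓ' = equiv-weaken ≤-refl ℓ≤ℓ' e

equiv-size≤ : ∀ {o o' ℓ A B} → o ≤ o' → Equiv o ℓ A B → Equiv o' ℓ A B
equiv-size≤ o≤o' = equiv-weaken o≤o' ≤-refl

equiv-size≡ : ∀ {o o' ℓ A B} → o ≡ o' → Equiv o ℓ A B → Equiv o' ℓ A B
equiv-size≡ refl e = e

equiv-cong : ∀ k {o₁ o₂ ℓ₁ ℓ₂ A A' B B'} → Equiv o₁ ℓ₁ A A' → Equiv o₂ ℓ₂ B B' →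
  Equiv (o₁ + o₂) (ℓ₁ + ℓ₂ + 21) (op k A B) (op k A' B')
equiv-cong k {o₁} {o₂} {ℓ₁} {ℓ₂} {A} {A'} {B} {B'} (equiv a a' aa' a'a) (equiv b b' bb' b'b) =
  equiv (≤-trans (≤-reflexive (size-op k A B)) (+-mono-≤ a b)) (≤-trans (≤-reflexive (size-op k A' B')) (+-mono-≤ a' b'))
        (monotone k a b a' b' aa' bb') (monotone k a' b' a b a'a b'b)
  where
  o : ℕ
  o = o₁ + o₂
  widenˡ : ∀ {n} → n ≤ o₁ → n ≤ o
  widenˡ n≤o₁ = ≤-trans n≤o₁ (m≤m+n o₁ o₂)
  widenʳ : ∀ {n} → n ≤ o₂ → n ≤ o
  widenʳ n≤o₂ = ≤-trans n≤o₂ (m≤n+m o₂ o₁)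
  widen₁ : ∀ {φ} → Prf o₁ ℓ₁ φ → Prf o ℓ₁ φ
  widen₁ = weaken (*-monoʳ-≤ K (m≤m+n o₁ o₂)) ≤-refl
  widen₂ : ∀ {φ} → Prf o₂ ℓ₂ φ → Prf o ℓ₂ φ
  widen₂ = weaken (*-monoʳ-≤ K (m≤n+m o₂ o₁)) ≤-refl
  monotone : ∀ k {C C' D D'} → C ≼ o₁ → D ≼ o₂ → C' ≼ o₁ → D' ≼ o₂ →
    Prf o₁ ℓ₁ (C ⇒ C') → Prf o₂ ℓ₂ (D ⇒ D') → Prf o (ℓ₁ + ℓ₂ + 21) (op k C D ⇒ op k C' D')
  monotone disj c d c' d' cc' dd' =
    weakenℓ (count ℓ₁ ℓ₂)
      (∨-elim (widenˡ c) (widenʳ d) (+-mono-≤ c' d')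
        (⇒-trans (widenˡ c) (widenˡ c') (+-mono-≤ c' d') (widen₁ cc') (∨-introˡ (widenˡ c') (widenʳ d')))
        (⇒-trans (widenʳ d) (widenʳ d') (+-mono-≤ c' d') (widen₂ dd') (∨-introʳ (widenˡ c') (widenʳ d'))))
    where
    count : ∀ x y → x + 1 + 5 + (y + 1 + 5) + 3 ≤ x + y + 21
    count x y = ≤-trans (≤-reflexive (exact x y)) (+-monoʳ-≤ (x + y) (lit≤ {15} {21}))
      where
      exact : ∀ x y → x + 1 + 5 + (y + 1 + 5) + 3 ≡ x + y + 15
      exact = solve-∀
  monotone conj c d c' d' cc' dd' =
    weakenℓ (≤-reflexive (count ℓ₁ ℓ₂))
      (∧-intro (+-mono-≤ c d) (widenˡ c') (widenʳ d')
        (⇒-trans (+-mono-≤ c d) (widenˡ c) (widenˡ c') (∧-elimˡ (widenˡ c) (widenʳ d)) (widen₁ cc'))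
        (⇒-trans (+-mono-≤ c d) (widenʳ d) (widenʳ d') (∧-elimʳ (widenˡ c) (widenʳ d)) (widen₂ dd')))
    where
    count : ∀ x y → 1 + x + 5 + (1 + y + 5) + 9 ≡ x + y + 21
    count = solve-∀

equiv-comm : ∀ k A B → Equiv (size A + size B) 11 (op k A B) (op k B A)
equiv-comm disj A B =
  equiv ≤-refl ba (weakenℓ lit≤ (∨-elim a b ba (∨-introʳ b a) (∨-introˡ b a)))
                  (weakenℓ lit≤ (∨-elim b a ≤-refl (∨-introʳ a b) (∨-introˡ a b)))
  where
  a : A ≼ size A + size B
  a = m≤m+n (size A) (size B)
  b : B ≼ size A + size B
  b = m≤n+m (size B) (size A)
  ba : size B + size A ≤ size A + size B
  ba = ≤-reflexive (+-comm (size B) (size A))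
equiv-comm conj A B =
  equiv ≤-refl ba (∧-intro ≤-refl b a (∧-elimʳ a b) (∧-elimˡ a b))
                  (∧-intro ba a b (∧-elimʳ b a) (∧-elimˡ b a))
  where
  a : A ≼ size A + size B
  a = m≤m+n (size A) (size B)
  b : B ≼ size A + size B
  b = m≤n+m (size B) (size A)
  ba : size B + size A ≤ size A + size B
  ba = ≤-reflexive (+-comm (size B) (size A))

equiv-assoc : ∀ k A B C → Equiv (size A + size B + size C) 33 (op k (op k A B) C) (op k A (op k B C))
equiv-assoc k A B C = by k
  where
  n : ℕ
  n = size A + size B + size C
  a : A ≼ n
  a = ≤-trans (m≤m+n (size A) (size B)) (m≤m+n _ (size C))
  b : B ≼ n
  b = ≤-trans (m≤n+m (size B) (size A)) (m≤m+n _ (size C))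
  c : C ≼ n
  c = m≤n+m (size C) _
  ab : size A + size B ≤ n
  ab = m≤m+n _ (size C)
  bc : size B + size C ≤ n
  bc = ≤-trans (m≤n+m _ (size A)) (≤-reflexive (sym (+-assoc (size A) (size B) (size C))))
  a[bc] : size A + (size B + size C) ≤ n
  a[bc] = ≤-reflexive (sym (+-assoc (size A) (size B) (size C)))
  by : ∀ k → Equiv n 33 (op k (op k A B) C) (op k A (op k B C))
  by disj = equiv ≤-refl a[bc]
    (weakenℓ lit≤ (∨-elim ab c a[bc]
      (∨-elim a b a[bc] (∨-introˡ a bc) (⇒-trans b bc a[bc] (∨-introˡ b c) (∨-introʳ a bc)))
      (⇒-trans c bc a[bc] (∨-introʳ b c) (∨-introʳ a bc))))
    (weakenℓ lit≤ (∨-elim a bc ≤-refl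
      (⇒-trans a ab ≤-refl (∨-introˡ a b) (∨-introˡ ab c))
      (∨-elim b c ≤-refl (⇒-trans b ab ≤-refl (∨-introʳ a b) (∨-introˡ ab c)) (∨-introʳ ab c))))
  by conj = equiv ≤-refl a[bc]
    (∧-intro ≤-refl a bc
      (⇒-trans ≤-refl ab a (∧-elimˡ ab c) (∧-elimˡ a b))
      (∧-intro ≤-refl b c (⇒-trans ≤-refl ab b (∧-elimˡ ab c) (∧-elimʳ a b)) (∧-elimʳ ab c)))
    (∧-intro a[bc] ab c
      (∧-intro a[bc] a b (∧-elimˡ a bc) (⇒-trans a[bc] bc b (∧-elimʳ a bc) (∧-elimˡ b c)))
      (⇒-trans a[bc] bc c (∧-elimʳ a bc) (∧-elimʳ b c)))

equiv-unit : ∀ k A → Equiv (size A + 1) 15 (op k A (unit k)) A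
equiv-unit disj A = equiv ≤-refl a (∨-elim a u a (⇒-refl a) (⊥⇒ a)) (weakenℓ lit≤ (∨-introˡ a u))
  where
  a : A ≼ size A + 1
  a = m≤m+n (size A) 1
  u : 1 ≤ size A + 1
  u = m≤n+m 1 (size A)
equiv-unit conj A = equiv ≤-refl a (weakenℓ lit≤ (∧-elimˡ a u)) (weakenℓ lit≤ (⇒∧⊤ a))
  where
  a : A ≼ size A + 1
  a = m≤m+n (size A) 1
  u : 1 ≤ size A + 1
  u = m≤n+m 1 (size A)

equiv-absorb : ∀ k → Equiv 2 11 (op k (absorbing k) (absorbing k)) (absorbing k)
equiv-absorb disj =
  equiv ≤-refl lit≤ (⇒⊤ {2} {⊤ᶠ ∨ᶠ ⊤ᶠ} ≤-refl) (weakenℓ lit≤ (∨-introˡ {2} {⊤ᶠ} {⊤ᶠ} lit≤ lit≤))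
equiv-absorb conj =
  equiv ≤-refl lit≤ (weakenℓ lit≤ (∧-elimˡ {2} {⊥ᶠ} {⊥ᶠ} lit≤ lit≤)) (weakenℓ lit≤ (⊥⇒ {2} {⊥ᶠ ∧ᶠ ⊥ᶠ} ≤-refl))

equiv-swap : ∀ k A B C → Equiv (size A + size B + size C) 113 (op k A (op k B C)) (op k B (op k A C))
equiv-swap k A B C =
  equiv-trans (equiv-trans (equiv-sym (equiv-assoc k A B C))
                           (equiv-cong k (equiv-comm k A B) (equiv-refl {size C} ≤-refl)))
              (equiv-size≡ (cong (_+ size C) (+-comm (size B) (size A))) (equiv-assoc k B A C))

equiv-medial : ∀ k A B C D → Equiv (size A + size B + (size C + size D)) 215
  (op k (op k A B) (op k C D)) (op k (op k A C) (op k B D))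
equiv-medial k A B C D =
  equiv-trans (equiv-trans (equiv-size≡ (cong (a + b +_) (size-op k C D)) (equiv-assoc k A B (op k C D)))
                           (equiv-size≡ (regroup₁ a b c d) (equiv-cong k (equiv-refl {a} ≤-refl) (equiv-swap k B C D))))
              (equiv-size≡ (trans (cong (a + c +_) (size-op k B D)) (regroup₂ a b c d))
                           (equiv-sym (equiv-assoc k A C (op k B D))))
  where
  a b c d : ℕ
  a = size A
  b = size B
  c = size C
  d = size D
  regroup₁ : ∀ a b c d → a + (b + c + d) ≡ a + b + (c + d)
  regroup₁ = solve-∀
  regroup₂ : ∀ a b c d → a + c + (b + d) ≡ a + b + (c + d)
  regroup₂ = solve-∀

-- Normal forms: a formula is flattened into nested n-ary ∨/∧-nodes whose
-- children are literals, units or nodes of the other connective. Units of a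
-- node are dropped; absorbing constants are recorded by a flag, since only
-- t ∨ t = t and f ∧ f = f are available, not t ∨ A = t.

data Nf : Set where
  tₙ fₙ : Nf
  leaf  : Fm → Nf
  node  : Conn → Bool → List Nf → Nf

unitₙ : Conn → Nf
unitₙ disj = fₙ
unitₙ conj = tₙ

absorbingₙ : Conn → Nf
absorbingₙ disj = tₙ
absorbingₙ conj = fₙ

-- The contents of a k-node: absorbing flag and list of children.
Flat : Set
Flat = Bool × List Nf

_⊕_ : Flat → Flat → Flat
(b , xs) ⊕ (c , ys) = (b or c) , (xs ++ ys)

flatten : Conn → Nf → Flat
flatten disj tₙ = true , []
flatten disj fₙ = false , []
flatten conj tₙ = false , []
flatten conj fₙ = true , []
flatten k (leaf φ) = false , leaf φ ∷ []
flatten disj (node disj b xs) = b , xs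
flatten disj (node conj b xs) = false , node conj b xs ∷ []
flatten conj (node conj b xs) = b , xs
flatten conj (node disj b xs) = false , node disj b xs ∷ []

build : Conn → Flat → Nf
build k (false , []) = unitₙ k
build k (true , []) = absorbingₙ k
build k (false , x ∷ []) = x
build k (true , x ∷ xs) = node k true (x ∷ xs)
build k (false , x ∷ y ∷ xs) = node k false (x ∷ y ∷ xs)

nf : CoS → Nf
nf 𝕗 = fₙ
nf 𝕥 = tₙ
nf (atom b i) = leaf (tr (atom b i))
nf (var b i) = leaf (tr (var b i))
nf (α ∨ β) = build disj (flatten disj (nf α) ⊕ flatten disj (nf β))
nf (α ∧ β) = build conj (flatten conj (nf α) ⊕ flatten conj (nf β))

Shape : Bool → List Nf → Set
Shape true (_ ∷ _) = Unit
Shape false (_ ∷ _ ∷ _) = Unit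
Shape _ _ = ⊥

mutual
  WellFormed : Nf → Set
  WellFormed (node k b xs) = Shape b xs × Children k xs
  WellFormed _ = Unit

  Children : Conn → List Nf → Set
  Children k [] = Unit
  Children k (x ∷ xs) = (flatten k x ≡ (false , x ∷ [])) × WellFormed x × Children k xs

flatten-build : ∀ k c → Children k (proj₂ c) → flatten k (build k c) ≡ c
flatten-build disj (false , []) _ = refl
flatten-build conj (false , []) _ = refl
flatten-build disj (true , []) _ = refl
flatten-build conj (true , []) _ = refl
flatten-build k (false , x ∷ []) (x-child , _) = x-child
flatten-build disj (true , x ∷ xs) _ = refl
flatten-build conj (true , x ∷ xs) _ = refl
flatten-build disj (false , x ∷ y ∷ xs) _ = refl
flatten-build conj (false , x ∷ y ∷ xs) _ = refl

build-flatten : ∀ k N → WellFormed N → build k (flatten k N) ≡ N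
build-flatten disj tₙ _ = refl
build-flatten conj tₙ _ = refl
build-flatten disj fₙ _ = refl
build-flatten conj fₙ _ = refl
build-flatten disj (leaf φ) _ = refl
build-flatten conj (leaf φ) _ = refl
build-flatten disj (node disj true (x ∷ xs)) _ = refl
build-flatten disj (node disj false (x ∷ y ∷ xs)) _ = refl
build-flatten disj (node conj b xs) _ = refl
build-flatten conj (node conj true (x ∷ xs)) _ = refl
build-flatten conj (node conj false (x ∷ y ∷ xs)) _ = refl
build-flatten conj (node disj b xs) _ = refl

Children-++ : ∀ k xs {ys} → Children k xs → Children k ys → Children k (xs ++ ys)
Children-++ k [] _ cs = cs
Children-++ k (x ∷ xs) (x-child , x-wf , xs-children) cs = x-child , x-wf , Children-++ k xs xs-children cs

Children-flatten : ∀ k N → WellFormed N → Children k (proj₂ (flatten k N))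
Children-flatten disj tₙ _ = tt
Children-flatten conj tₙ _ = tt
Children-flatten disj fₙ _ = tt
Children-flatten conj fₙ _ = tt
Children-flatten disj (leaf φ) _ = refl , tt , tt
Children-flatten conj (leaf φ) _ = refl , tt , tt
Children-flatten disj (node disj b xs) (_ , cs) = cs
Children-flatten disj (node conj b xs) wf = refl , wf , tt
Children-flatten conj (node conj b xs) (_ , cs) = cs
Children-flatten conj (node disj b xs) wf = refl , wf , tt

WellFormed-build : ∀ k c → Children k (proj₂ c) → WellFormed (build k c)
WellFormed-build disj (false , []) _ = tt
WellFormed-build conj (false , []) _ = tt
WellFormed-build disj (true , []) _ = tt
WellFormed-build conj (true , []) _ = tt
WellFormed-build k (false , x ∷ []) (_ , x-wf , _) = x-wf
WellFormed-build k (true , x ∷ xs) cs = tt , cs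
WellFormed-build k (false , x ∷ y ∷ xs) cs = tt , cs

flat : Conn → CoS → Flat
flat k α = flatten k (nf α)

children-nf : ∀ k α → Children k (proj₂ (flat k α))
WellFormed-nf : ∀ α → WellFormed (nf α)

children-nf k α = Children-flatten k (nf α) (WellFormed-nf α)

WellFormed-nf 𝕗 = tt
WellFormed-nf 𝕥 = tt
WellFormed-nf (atom b i) = tt
WellFormed-nf (var b i) = tt
WellFormed-nf (α ∨ β) =
  WellFormed-build disj (flat disj α ⊕ flat disj β) (Children-++ disj (proj₂ (flatten disj (nf α))) (children-nf disj α) (children-nf disj β))
WellFormed-nf (α ∧ β) =
  WellFormed-build conj (flat conj α ⊕ flat conj β) (Children-++ conj (proj₂ (flatten conj (nf α))) (children-nf conj α) (children-nf conj β))

data Select (y : Nf) : List Nf → List Nf → Set where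
  here  : ∀ {ys} → Select y (y ∷ ys) ys
  there : ∀ {z ys ys'} → Select y ys ys' → Select y (z ∷ ys) (z ∷ ys')

mutual
  data _≈_ : Nf → Nf → Set where
    t≈ : tₙ ≈ tₙ
    f≈ : fₙ ≈ fₙ
    leaf≈ : ∀ {φ} → leaf φ ≈ leaf φ
    node≈ : ∀ {k b xs ys} → xs ⋈ ys → node k b xs ≈ node k b ys

  data _⋈_ : List Nf → List Nf → Set where
    []⋈ : [] ⋈ []
    ∷⋈  : ∀ {x y xs ys ys'} → x ≈ y → Select y ys ys' → xs ⋈ ys' → (x ∷ xs) ⋈ ys

mutual
  ≈-refl : ∀ N → N ≈ N
  ≈-refl tₙ = t≈
  ≈-refl fₙ = f≈
  ≈-refl (leaf φ) = leaf≈
  ≈-refl (node k b xs) = node≈ (⋈-refl xs)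

  ⋈-refl : ∀ xs → xs ⋈ xs
  ⋈-refl [] = []⋈
  ⋈-refl (x ∷ xs) = ∷⋈ (≈-refl x) here (⋈-refl xs)

⋈-insert : ∀ {y x ys ys' xs} → Select y ys ys' → ys' ⋈ xs → y ≈ x → ys ⋈ (x ∷ xs)
⋈-insert here r y≈x = ∷⋈ y≈x here r
⋈-insert (there s) (∷⋈ z≈ s' r) y≈x = ∷⋈ z≈ (there s') (⋈-insert s r y≈x)

mutual
  ≈-sym : ∀ {N M} → N ≈ M → M ≈ N
  ≈-sym t≈ = t≈
  ≈-sym f≈ = f≈
  ≈-sym leaf≈ = leaf≈
  ≈-sym (node≈ r) = node≈ (⋈-sym r)

  ⋈-sym : ∀ {xs ys} → xs ⋈ ys → ys ⋈ xs
  ⋈-sym []⋈ = []⋈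
  ⋈-sym (∷⋈ x≈y s r) = ⋈-insert s (⋈-sym r) (≈-sym x≈y)

select-swap : ∀ {u z zs zs₁ zs₂} → Select u zs zs₁ → Select z zs₁ zs₂ →
  Σ (List Nf) λ zs₃ → Select z zs zs₃ × Select u zs₃ zs₂
select-swap here s = _ , there s , here
select-swap (there s₁) here = _ , here , s₁
select-swap (there s₁) (there s₂) with select-swap s₁ s₂
... | _ , s₃ , s₄ = _ , there s₃ , there s₄

select-⋈ : ∀ {y ys ys' zs} → Select y ys ys' → ys ⋈ zs →
  Σ Nf λ z → Σ (List Nf) λ zs' → (y ≈ z) × Select z zs zs' × (ys' ⋈ zs')
select-⋈ here (∷⋈ y≈z s r) = _ , _ , y≈z , s , r
select-⋈ (there s) (∷⋈ u≈ su r) with select-⋈ s r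
... | z , _ , y≈z , sz , r' with select-swap su sz
... | _ , s₁ , s₂ = z , _ , y≈z , s₁ , ∷⋈ u≈ s₂ r'

mutual
  ≈-trans : ∀ {N M L} → N ≈ M → M ≈ L → N ≈ L
  ≈-trans t≈ t≈ = t≈
  ≈-trans f≈ f≈ = f≈
  ≈-trans leaf≈ leaf≈ = leaf≈
  ≈-trans (node≈ r) (node≈ r') = node≈ (⋈-trans r r')

  ⋈-trans : ∀ {xs ys zs} → xs ⋈ ys → ys ⋈ zs → xs ⋈ zs
  ⋈-trans []⋈ []⋈ = []⋈
  ⋈-trans (∷⋈ x≈y s r) q with select-⋈ s q
  ... | _ , _ , y≈z , s' , r' = ∷⋈ (≈-trans x≈y y≈z) s' (⋈-trans r r')

select-++ : ∀ {y ys ys'} ws → Select y ys ys' → Select y (ys ++ ws) (ys' ++ ws)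
select-++ ws here = here
select-++ ws (there s) = there (select-++ ws s)

⋈-++ : ∀ {xs ys zs ws} → xs ⋈ ys → zs ⋈ ws → (xs ++ zs) ⋈ (ys ++ ws)
⋈-++ []⋈ q = q
⋈-++ {ws = ws} (∷⋈ x≈y s r) q = ∷⋈ x≈y (select-++ ws s) (⋈-++ r q)

select-middle : ∀ {x} ys {xs} → Select x (ys ++ x ∷ xs) (ys ++ xs)
select-middle [] = here
select-middle (y ∷ ys) = there (select-middle ys)

⋈-swap : ∀ xs ys → (xs ++ ys) ⋈ (ys ++ xs)
⋈-swap [] ys = subst (ys ⋈_) (sym (++-identityʳ ys)) (⋈-refl ys)
⋈-swap (x ∷ xs) ys = ∷⋈ (≈-refl x) (select-middle ys) (⋈-swap xs ys)

⋈-length : ∀ {xs ys} → xs ⋈ ys → length xs ≡ length ys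
⋈-length []⋈ = refl
⋈-length (∷⋈ _ s r) = trans (cong suc (⋈-length r)) (sym (select-length s))
  where
  select-length : ∀ {y ys ys'} → Select y ys ys' → length ys ≡ suc (length ys')
  select-length here = refl
  select-length (there s) = cong suc (select-length s)

_≈ᶠ_ : Flat → Flat → Set
c ≈ᶠ d = (proj₁ c ≡ proj₁ d) × (proj₂ c ⋈ proj₂ d)

≈ᶠ-refl : ∀ c → c ≈ᶠ c
≈ᶠ-refl (b , xs) = refl , ⋈-refl xs

build-cong : ∀ k {c d} → c ≈ᶠ d → build k c ≈ build k d
build-cong k {b , xs} {.b , ys} (refl , r) = by b xs ys r (⋈-length r)
  where
  by : ∀ b xs ys → xs ⋈ ys → length xs ≡ length ys → build k (b , xs) ≈ build k (b , ys)
  by false [] [] _ _ = ≈-refl _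
  by true [] [] _ _ = ≈-refl _
  by false (x ∷ []) (y ∷ []) (∷⋈ x≈y here []⋈) _ = x≈y
  by false (x ∷ x' ∷ xs) (y ∷ y' ∷ ys) r _ = node≈ r
  by true (x ∷ xs) (y ∷ ys) r _ = node≈ r

flatten-cong : ∀ k {N M} → N ≈ M → flatten k N ≈ᶠ flatten k M
flatten-cong disj t≈ = ≈ᶠ-refl _
flatten-cong conj t≈ = ≈ᶠ-refl _
flatten-cong disj f≈ = ≈ᶠ-refl _
flatten-cong conj f≈ = ≈ᶠ-refl _
flatten-cong disj leaf≈ = ≈ᶠ-refl _
flatten-cong conj leaf≈ = ≈ᶠ-refl _
flatten-cong disj (node≈ {disj} r) = refl , r
flatten-cong disj (node≈ {conj} r) = refl , ∷⋈ (node≈ r) here []⋈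
flatten-cong conj (node≈ {conj} r) = refl , r
flatten-cong conj (node≈ {disj} r) = refl , ∷⋈ (node≈ r) here []⋈

⊕-cong : ∀ {c c' d d'} → c ≈ᶠ c' → d ≈ᶠ d' → (c ⊕ d) ≈ᶠ (c' ⊕ d')
⊕-cong {c , _} {.c , _} {d , _} {.d , _} (refl , r) (refl , r') = refl , ⋈-++ r r'

⊕-comm : ∀ c d → (c ⊕ d) ≈ᶠ (d ⊕ c)
⊕-comm (b , xs) (c , ys) = or-comm b c , ⋈-swap xs ys

⊕-assoc : ∀ c d e → (c ⊕ d) ⊕ e ≡ c ⊕ (d ⊕ e)
⊕-assoc (b , xs) (c , ys) (d , zs) = cong₂ _,_ (or-assoc b c d) (++-assoc xs ys zs)

⊕-identityʳ : ∀ c → c ⊕ (false , []) ≡ c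
⊕-identityʳ (b , xs) = cong₂ _,_ (or-identityʳ b) (++-identityʳ xs)

≡⇒≈ : ∀ {N M} → N ≡ M → N ≈ M
≡⇒≈ {N} refl = ≈-refl N

nf-assoc : ∀ k α β γ →
  build k (flatten k (build k (flat k α ⊕ flat k β)) ⊕ flat k γ) ≈ build k (flat k α ⊕ flatten k (build k (flat k β ⊕ flat k γ)))
nf-assoc k α β γ = ≡⇒≈ (begin
  build k (flatten k (build k (flat k α ⊕ flat k β)) ⊕ flat k γ)
    ≡⟨ cong (λ c → build k (c ⊕ flat k γ)) (flatten-build k (flat k α ⊕ flat k β) (Children-++ k _ (children-nf k α) (children-nf k β))) ⟩
  build k ((flat k α ⊕ flat k β) ⊕ flat k γ)
    ≡⟨ cong (build k) (⊕-assoc (flat k α) (flat k β) (flat k γ)) ⟩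
  build k (flat k α ⊕ (flat k β ⊕ flat k γ))
    ≡⟨ cong (λ c → build k (flat k α ⊕ c)) (flatten-build k (flat k β ⊕ flat k γ) (Children-++ k _ (children-nf k β) (children-nf k γ))) ⟨
  build k (flat k α ⊕ flatten k (build k (flat k β ⊕ flat k γ))) ∎)
  where open ≡-Reasoning

nf-unit : ∀ k α → build k (flat k α ⊕ (false , [])) ≈ nf α
nf-unit k α = ≡⇒≈ (trans (cong (build k) (⊕-identityʳ (flat k α))) (build-flatten k (nf α) (WellFormed-nf α)))

nf-axiom : ∀ {α β} → EqAx α β → nf α ≈ nf β
nf-axiom (∨-comm α β) = build-cong disj (⊕-comm (flat disj α) (flat disj β))
nf-axiom (∧-comm α β) = build-cong conj (⊕-comm (flat conj α) (flat conj β))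
nf-axiom (∨-assoc α β γ) = nf-assoc disj α β γ
nf-axiom (∧-assoc α β γ) = nf-assoc conj α β γ
nf-axiom (∨-unit α) = nf-unit disj α
nf-axiom (∧-unit α) = nf-unit conj α
nf-axiom 𝕥∨𝕥 = t≈
nf-axiom 𝕗∧𝕗 = f≈

nf-context : ∀ ξ {α β} → nf α ≈ nf β → nf (ξ ⟦ α ⟧) ≈ nf (ξ ⟦ β ⟧)
nf-context □ h = h
nf-context (ξ ∨ₗ γ) h = build-cong disj (⊕-cong (flatten-cong disj (nf-context ξ h)) (≈ᶠ-refl (flat disj γ)))
nf-context (γ ∨ᵣ ξ) h = build-cong disj (⊕-cong (≈ᶠ-refl (flat disj γ)) (flatten-cong disj (nf-context ξ h)))
nf-context (ξ ∧ₗ γ) h = build-cong conj (⊕-cong (flatten-cong conj (nf-context ξ h)) (≈ᶠ-refl (flat conj γ)))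
nf-context (γ ∧ᵣ ξ) h = build-cong conj (⊕-cong (≈ᶠ-refl (flat conj γ)) (flatten-cong conj (nf-context ξ h)))

nf-respects : ∀ {α β} → α ≐ β → nf α ≈ nf β
nf-respects (ax e) = nf-axiom e
nf-respects refl≐ = ≈-refl _
nf-respects (sym≐ p) = ≈-sym (nf-respects p)
nf-respects (trans≐ p q) = ≈-trans (nf-respects p) (nf-respects q)
nf-respects (ctx ξ p) = nf-context ξ (nf-respects p)

flag : Conn → Bool → Fm
flag k false = unit k
flag k true = absorbing k

mutual
  embed : Nf → Fm
  embed tₙ = ⊤ᶠ
  embed fₙ = ⊥ᶠ
  embed (leaf φ) = φ
  embed (node k b xs) = op k (flag k b) (embedList k xs)

  embedList : Conn → List Nf → Fm
  embedList k [] = unit k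
  embedList k (x ∷ xs) = op k (embed x) (embedList k xs)

embedFlat : Conn → Flat → Fm
embedFlat k (b , xs) = op k (flag k b) (embedList k xs)

mutual
  nsize : Nf → ℕ
  nsize tₙ = 1
  nsize fₙ = 1
  nsize (leaf φ) = size φ
  nsize (node k b xs) = 1 + lsize xs

  lsize : List Nf → ℕ
  lsize [] = 1
  lsize (x ∷ xs) = nsize x + lsize xs

fsize : Flat → ℕ
fsize (b , xs) = 1 + lsize xs

size-flag : ∀ k b → size (flag k b) ≡ 1
size-flag k false = size-unit k
size-flag k true = size-absorbing k

mutual
  size-embed : ∀ N → size (embed N) ≡ nsize N
  size-embed tₙ = refl
  size-embed fₙ = refl
  size-embed (leaf φ) = refl
  size-embed (node k b xs) = trans (size-op k (flag k b) (embedList k xs)) (cong₂ _+_ (size-flag k b) (size-embedList k xs))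

  size-embedList : ∀ k xs → size (embedList k xs) ≡ lsize xs
  size-embedList k [] = size-unit k
  size-embedList k (x ∷ xs) = trans (size-op k (embed x) (embedList k xs)) (cong₂ _+_ (size-embed x) (size-embedList k xs))

nsize-pos : ∀ N → 1 ≤ nsize N
nsize-pos tₙ = ≤-refl
nsize-pos fₙ = ≤-refl
nsize-pos (leaf φ) = size-pos φ
nsize-pos (node k b xs) = s≤s z≤n

lsize-pos : ∀ xs → 1 ≤ lsize xs
lsize-pos [] = ≤-refl
lsize-pos (x ∷ xs) = ≤-trans (nsize-pos x) (m≤m+n _ _)

absorb-constant : ∀ C c a s → c ≤ C → 1 ≤ a → c + C * s ≤ C * (a + s)
absorb-constant C c a s c≤C 1≤a =
  ≤-trans (+-monoˡ-≤ (C * s) (≤-trans c≤C (≤-trans (≤-reflexive (sym (*-identityʳ C))) (*-monoʳ-≤ C 1≤a))))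
          (≤-reflexive (sym (*-distribˡ-+ C a s)))

scale-constant : ∀ c C x → 1 ≤ x → c + C * x ≤ (c + C) * x
scale-constant c C x 1≤x =
  ≤-trans (+-monoˡ-≤ (C * x) (≤-trans (≤-reflexive (sym (*-identityʳ c))) (*-monoʳ-≤ c 1≤x)))
          (≤-reflexive (sym (*-distribʳ-+ x c C)))

square : ℕ → ℕ
square n = n * n

square-superadditive : ∀ C c a b → c ≤ C → 1 ≤ a → 1 ≤ b →
  C * square a + C * square b + c * (a + b) ≤ C * square (a + b)
square-superadditive C c a b c≤C 1≤a 1≤b =
  ≤-trans (+-monoʳ-≤ (C * square a + C * square b) (≤-trans (*-monoˡ-≤ (a + b) c≤C) (*-monoʳ-≤ C a+b≤2ab)))
          (≤-reflexive (expand C a b))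
  where
  a+b≤2ab : a + b ≤ a * b + a * b
  a+b≤2ab = +-mono-≤ (≤-trans (≤-reflexive (sym (*-identityʳ a))) (*-monoʳ-≤ a 1≤b))
                     (≤-trans (≤-reflexive (sym (*-identityˡ b))) (*-monoˡ-≤ b 1≤a))
  expand : ∀ C a b → C * (a * a) + C * (b * b) + C * (a * b + a * b) ≡ C * ((a + b) * (a + b))
  expand = solve-∀

-- unit ∘ (A ∘ unit) ⇔ A: the embedding of a node with a single child.
equiv-padded : ∀ k A → Equiv (size A + 2) 51 (op k (unit k) (op k A (unit k))) A
equiv-padded k A =
  equiv-trans (equiv-size≡ outer (equiv-comm k (unit k) (op k A (unit k))))
    (equiv-trans (equiv-size≡ inner (equiv-unit k (op k A (unit k))))
                 (equiv-size≤ (+-monoʳ-≤ (size A) lit≤) (equiv-unit k A)))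
  where
  size-A∘unit : size (op k A (unit k)) ≡ size A + 1
  size-A∘unit = trans (size-op k A (unit k)) (cong (size A +_) (size-unit k))
  inner : size (op k A (unit k)) + 1 ≡ size A + 2
  inner = trans (cong (_+ 1) size-A∘unit) (+-assoc (size A) 1 1)
  outer : size (unit k) + size (op k A (unit k)) ≡ size A + 2
  outer = trans (cong₂ _+_ (size-unit k) refl) (trans (+-comm 1 _) inner)

flatten-equiv : ∀ k N → Equiv (nsize N + 2) 51 (embed N) (embedFlat k (flatten k N))
flatten-equiv disj tₙ = equiv-weaken lit≤ lit≤ (equiv-sym (equiv-unit disj ⊤ᶠ))
flatten-equiv conj tₙ = equiv-weaken lit≤ lit≤ (equiv-sym (equiv-unit conj ⊤ᶠ))
flatten-equiv disj fₙ = equiv-weaken lit≤ lit≤ (equiv-sym (equiv-unit disj ⊥ᶠ))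
flatten-equiv conj fₙ = equiv-weaken lit≤ lit≤ (equiv-sym (equiv-unit conj ⊥ᶠ))
flatten-equiv disj (leaf φ) = equiv-sym (equiv-padded disj φ)
flatten-equiv conj (leaf φ) = equiv-sym (equiv-padded conj φ)
flatten-equiv disj N@(node disj b xs) = equiv-weaken (≤-trans (≤-reflexive (size-embed N)) (m≤m+n _ 2)) lit≤ (equiv-refl ≤-refl)
flatten-equiv conj N@(node conj b xs) = equiv-weaken (≤-trans (≤-reflexive (size-embed N)) (m≤m+n _ 2)) lit≤ (equiv-refl ≤-refl)
flatten-equiv disj N@(node conj b xs) = equiv-size≡ (cong (_+ 2) (size-embed N)) (equiv-sym (equiv-padded disj (embed N)))
flatten-equiv conj N@(node disj b xs) = equiv-size≡ (cong (_+ 2) (size-embed N)) (equiv-sym (equiv-padded conj (embed N)))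

build-equiv : ∀ k c → Equiv (fsize c) 51 (embedFlat k c) (embed (build k c))
build-equiv disj (false , []) = equiv-unit disj ⊥ᶠ ⟨≤ lit≤
build-equiv conj (false , []) = equiv-unit conj ⊤ᶠ ⟨≤ lit≤
build-equiv disj (true , []) = equiv-unit disj ⊤ᶠ ⟨≤ lit≤
build-equiv conj (true , []) = equiv-unit conj ⊥ᶠ ⟨≤ lit≤
build-equiv k (false , x ∷ []) = equiv-size≡ (trans (cong (_+ 2) (size-embed x)) (+-suc (nsize x) 1)) (equiv-padded k (embed x))
build-equiv k (true , xs@(_ ∷ _)) = equiv-refl (≤-reflexive (size-embed (node k true xs))) ⟨≤ lit≤
build-equiv k (false , xs@(_ ∷ _ ∷ _)) = equiv-refl (≤-reflexive (size-embed (node k false xs))) ⟨≤ lit≤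

flag-equiv : ∀ k b c → Equiv 2 31 (op k (flag k b) (flag k c)) (flag k (b or c))
flag-equiv k false false = equiv-size≡ (cong (_+ 1) (size-unit k)) (equiv-unit k (unit k)) ⟨≤ lit≤
flag-equiv k true false = equiv-size≡ (cong (_+ 1) (size-absorbing k)) (equiv-unit k (absorbing k)) ⟨≤ lit≤
flag-equiv k false true =
  equiv-trans (equiv-size≡ (cong₂ _+_ (size-unit k) (size-absorbing k)) (equiv-comm k (unit k) (absorbing k)))
              (equiv-size≡ (cong (_+ 1) (size-absorbing k)) (equiv-unit k (absorbing k)))
flag-equiv k true true = equiv-absorb k ⟨≤ lit≤

append-equiv : ∀ k xs ys →
  Equiv (lsize xs + lsize ys) (64 * lsize xs + 31) (op k (embedList k xs) (embedList k ys)) (embedList k (xs ++ ys))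
append-equiv k [] ys =
  equiv-trans (equiv-size≡ (cong₂ _+_ (size-unit k) (size-embedList k ys)) (equiv-comm k (unit k) (embedList k ys)))
              (equiv-size≤ (≤-reflexive (trans (cong (_+ 1) (size-embedList k ys)) (+-comm (lsize ys) 1)))
                           (equiv-unit k (embedList k ys)))
  ⟨≤ m≤n+m 31 (64 * 1)
append-equiv k (x ∷ xs) ys =
  equiv-trans (equiv-size≡ sizes (equiv-assoc k (embed x) (embedList k xs) (embedList k ys)))
              (equiv-size≡ sizes' (equiv-cong k (equiv-refl {size (embed x)} ≤-refl) (append-equiv k xs ys)))
  ⟨≤ length≤ (nsize x) (lsize xs) (nsize-pos x)
  where
  sizes : size (embed x) + size (embedList k xs) + size (embedList k ys) ≡ nsize x + lsize xs + lsize ys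
  sizes = cong₂ _+_ (cong₂ _+_ (size-embed x) (size-embedList k xs)) (size-embedList k ys)
  sizes' : size (embed x) + (lsize xs + lsize ys) ≡ nsize x + lsize xs + lsize ys
  sizes' = trans (cong (_+ (lsize xs + lsize ys)) (size-embed x)) (sym (+-assoc (nsize x) (lsize xs) (lsize ys)))
  length≤ : ∀ a s → 1 ≤ a → 33 + (5 + (64 * s + 31) + 21) + 5 ≤ 64 * (a + s) + 31
  length≤ a s 1≤a = ≤-trans (≤-reflexive (exact s)) (+-monoˡ-≤ 31 (absorb-constant 64 64 a s ≤-refl 1≤a))
    where
    exact : ∀ s → 33 + (5 + (64 * s + 31) + 21) + 5 ≡ 64 + 64 * s + 31
    exact = solve-∀

merge-equiv : ∀ k c d →
  Equiv (fsize c + fsize d) (400 * (fsize c + fsize d)) (op k (embedFlat k c) (embedFlat k d)) (embedFlat k (c ⊕ d))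
merge-equiv k (b , xs) (b' , ys) =
  equiv-trans (equiv-size≡ sizes (equiv-medial k (flag k b) (embedList k xs) (flag k b') (embedList k ys)))
              (equiv-size≤ (≤-reflexive (regroup (lsize xs) (lsize ys))) (equiv-cong k (flag-equiv k b b') (append-equiv k xs ys)))
  ⟨≤ length≤ (lsize xs) (lsize ys)
  where
  sizes : size (flag k b) + size (embedList k xs) + (size (flag k b') + size (embedList k ys)) ≡ 1 + lsize xs + (1 + lsize ys)
  sizes = cong₂ _+_ (cong₂ _+_ (size-flag k b) (size-embedList k xs)) (cong₂ _+_ (size-flag k b') (size-embedList k ys))
  regroup : ∀ s t → 2 + (s + t) ≡ 1 + s + (1 + t)
  regroup = solve-∀
  length≤ : ∀ s t → 215 + (31 + (64 * s + 31) + 21) + 5 ≤ 400 * (1 + s + (1 + t))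
  length≤ s t = ≤-trans (≤-reflexive (exact s)) (≤-trans (+-monoˡ-≤ 303 (*-monoˡ-≤ s (lit≤ {64} {400})))
                  (≤-trans (+-monoʳ-≤ (400 * s) (m≤m+n 303 (497 + 400 * t))) (≤-reflexive (expand s t))))
    where
    exact : ∀ s → 215 + (31 + (64 * s + 31) + 21) + 5 ≡ 64 * s + 303
    exact = solve-∀
    expand : ∀ s t → 400 * s + (303 + (497 + 400 * t)) ≡ 400 * (1 + s + (1 + t))
    expand = solve-∀

select-lsize : ∀ {y ys ys'} → Select y ys ys' → lsize ys ≡ nsize y + lsize ys'
select-lsize here = refl
select-lsize {y} (there {z} {ws} {ws'} s) = trans (cong (nsize z +_) (select-lsize s)) (+-comm-middle (nsize z) (nsize y) (lsize ws'))
  where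
  +-comm-middle : ∀ a b c → a + (b + c) ≡ b + (a + c)
  +-comm-middle a b c = trans (sym (+-assoc a b c)) (trans (cong (_+ c) (+-comm a b)) (+-assoc b a c))

mutual
  ≈-nsize : ∀ {N M} → N ≈ M → nsize N ≡ nsize M
  ≈-nsize t≈ = refl
  ≈-nsize f≈ = refl
  ≈-nsize leaf≈ = refl
  ≈-nsize (node≈ r) = cong suc (⋈-lsize r)

  ⋈-lsize : ∀ {xs ys} → xs ⋈ ys → lsize xs ≡ lsize ys
  ⋈-lsize []⋈ = refl
  ⋈-lsize (∷⋈ x≈y s r) = trans (cong₂ _+_ (≈-nsize x≈y) (⋈-lsize r)) (sym (select-lsize s))

select-equiv : ∀ k {y ys ys'} → Select y ys ys' →
  Equiv (lsize ys) (144 * lsize ys) (op k (embed y) (embedList k ys')) (embedList k ys)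
select-equiv k {y} {ys} {ys'} here =
  equiv-refl (≤-reflexive (trans (size-op k (embed y) (embedList k ys')) (cong₂ _+_ (size-embed y) (size-embedList k ys'))))
  ⟨≤ ≤-trans (lit≤ {5} {144 * 1}) (*-monoʳ-≤ 144 (lsize-pos ys))
select-equiv k {y} (there {z} {ws} {ws'} s) =
  equiv-trans (equiv-size≡ sizes (equiv-swap k (embed y) (embed z) (embedList k ws')))
              (equiv-size≡ (cong (_+ lsize ws) (size-embed z)) (equiv-cong k (equiv-refl {size (embed z)} ≤-refl) (select-equiv k s)))
  ⟨≤ length≤ (nsize z) (lsize ws) (nsize-pos z)
  where
  sizes : size (embed y) + size (embed z) + size (embedList k ws') ≡ nsize z + lsize ws
  sizes = begin
    size (embed y) + size (embed z) + size (embedList k ws')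
      ≡⟨ cong₂ _+_ (cong₂ _+_ (size-embed y) (size-embed z)) (size-embedList k ws') ⟩
    nsize y + nsize z + lsize ws'
      ≡⟨ cong (_+ lsize ws') (+-comm (nsize y) (nsize z)) ⟩
    nsize z + nsize y + lsize ws'
      ≡⟨ +-assoc (nsize z) (nsize y) (lsize ws') ⟩
    nsize z + (nsize y + lsize ws')
      ≡⟨ cong (nsize z +_) (select-lsize s) ⟨
    nsize z + lsize ws ∎
    where open ≡-Reasoning
  length≤ : ∀ a s → 1 ≤ a → 113 + (5 + 144 * s + 21) + 5 ≤ 144 * (a + s)
  length≤ a s 1≤a = ≤-trans (≤-reflexive (exact s)) (absorb-constant 144 144 a s ≤-refl 1≤a)
    where
    exact : ∀ s → 113 + (5 + 144 * s + 21) + 5 ≡ 144 + 144 * s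
    exact = solve-∀

-- Normal forms equal up to ⋈ have embeddings equivalent by a proof of length
-- quadratic in the size: each child is moved into place by select-equiv.

mutual
  ≈-equiv : ∀ {N M} → N ≈ M → Equiv (nsize N) (200 * square (nsize N)) (embed N) (embed M)
  ≈-equiv t≈ = equiv-refl ≤-refl ⟨≤ lit≤
  ≈-equiv f≈ = equiv-refl ≤-refl ⟨≤ lit≤
  ≈-equiv (leaf≈ {φ}) = equiv-refl ≤-refl ⟨≤ five≤ (size-pos φ)
    where
    five≤ : ∀ {s} → 1 ≤ s → 5 ≤ 200 * square s
    five≤ 1≤s = ≤-trans (lit≤ {5} {200 * square 1}) (*-monoʳ-≤ 200 (*-mono-≤ 1≤s 1≤s))
  ≈-equiv (node≈ {k} {b} {xs} r) =
    equiv-cong k (equiv-refl {1} {flag k b} (≤-reflexive (size-flag k b))) (⋈-equiv k r) ⟨≤ node≤ (lsize xs)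
    where
    node≤ : ∀ s → 5 + 200 * square s + 21 ≤ 200 * square (1 + s)
    node≤ s = ≤-trans (≤-reflexive (exact s)) (≤-trans (+-monoʳ-≤ (200 * square s) (m≤m+n 26 (174 + 400 * s))) (≤-reflexive (expand s)))
      where
      exact : ∀ s → 5 + 200 * (s * s) + 21 ≡ 200 * (s * s) + 26
      exact = solve-∀
      expand : ∀ s → 200 * (s * s) + (26 + (174 + 400 * s)) ≡ 200 * ((1 + s) * (1 + s))
      expand = solve-∀

  ⋈-equiv : ∀ k {xs ys} → xs ⋈ ys → Equiv (lsize xs) (200 * square (lsize xs)) (embedList k xs) (embedList k ys)
  ⋈-equiv k []⋈ = equiv-size≡ (size-unit k) (equiv-refl {size (unit k)} ≤-refl) ⟨≤ lit≤
  ⋈-equiv k (∷⋈ {x} {y} {xs} {ys} {ys'} x≈y s r) =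
    equiv-trans (equiv-cong k (≈-equiv x≈y) (⋈-equiv k r))
                (equiv-size≡ lsize-ys (select-equiv k s ⟨≤ ≤-reflexive (cong (144 *_) lsize-ys)))
    ⟨≤ cons≤ (nsize x) (lsize xs) (nsize-pos x) (lsize-pos xs)
    where
    lsize-ys : lsize ys ≡ nsize x + lsize xs
    lsize-ys = trans (select-lsize s) (sym (cong₂ _+_ (≈-nsize x≈y) (⋈-lsize r)))
    cons≤ : ∀ a b → 1 ≤ a → 1 ≤ b → 200 * square a + 200 * square b + 21 + 144 * (a + b) + 5 ≤ 200 * square (a + b)
    cons≤ a b 1≤a 1≤b =
      ≤-trans (≤-reflexive (exact a b))
              (≤-trans (+-monoʳ-≤ (200 * square a + 200 * square b) (scale-constant 26 144 (a + b) (≤-trans 1≤a (m≤m+n a b))))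
                       (square-superadditive 200 170 a b lit≤ 1≤a 1≤b))
      where
      exact : ∀ a b → 200 * (a * a) + 200 * (b * b) + 21 + 144 * (a + b) + 5 ≡ 200 * (a * a) + 200 * (b * b) + (26 + 144 * (a + b))
      exact = solve-∀

-- Sizes along normalisation: flattening adds at most 2, building does not
-- increase the size, merging saves 2, so nsize (nf α) + 2 ≤ 3 ∣ α ∣.

flatten-fsize : ∀ k N → fsize (flatten k N) ≤ nsize N + 2
flatten-fsize disj tₙ = lit≤
flatten-fsize conj tₙ = lit≤
flatten-fsize disj fₙ = lit≤
flatten-fsize conj fₙ = lit≤
flatten-fsize disj (leaf φ) = ≤-reflexive (sym (+-suc (size φ) 1))
flatten-fsize conj (leaf φ) = ≤-reflexive (sym (+-suc (size φ) 1))
flatten-fsize disj (node disj b xs) = m≤m+n _ 2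
flatten-fsize disj (node conj b xs) = ≤-reflexive (sym (+-suc (1 + lsize xs) 1))
flatten-fsize conj (node conj b xs) = m≤m+n _ 2
flatten-fsize conj (node disj b xs) = ≤-reflexive (sym (+-suc (1 + lsize xs) 1))

build-nsize : ∀ k c → nsize (build k c) ≤ fsize c
build-nsize disj (false , []) = lit≤
build-nsize conj (false , []) = lit≤
build-nsize disj (true , []) = lit≤
build-nsize conj (true , []) = lit≤
build-nsize k (false , x ∷ []) = ≤-trans (m≤m+n (nsize x) 1) (m≤n+m _ 1)
build-nsize k (true , x ∷ xs) = ≤-refl
build-nsize k (false , x ∷ y ∷ xs) = ≤-refl

lsize-++ : ∀ xs ys → lsize (xs ++ ys) + 1 ≡ lsize xs + lsize ys
lsize-++ [] ys = +-comm (lsize ys) 1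
lsize-++ (x ∷ xs) ys = trans (+-assoc (nsize x) (lsize (xs ++ ys)) 1)
                             (trans (cong (nsize x +_) (lsize-++ xs ys)) (sym (+-assoc (nsize x) (lsize xs) (lsize ys))))

fsize-⊕ : ∀ c d → fsize (c ⊕ d) + 2 ≡ fsize c + fsize d
fsize-⊕ (b , xs) (b' , ys) = begin
  1 + lsize (xs ++ ys) + 2    ≡⟨ cong suc (+-suc (lsize (xs ++ ys)) 1) ⟩
  2 + (lsize (xs ++ ys) + 1)  ≡⟨ cong (2 +_) (lsize-++ xs ys) ⟩
  2 + (lsize xs + lsize ys)   ≡⟨ cong suc (+-suc (lsize xs) (lsize ys)) ⟨
  1 + lsize xs + (1 + lsize ys) ∎
  where open ≡-Reasoning

size-tr : ∀ α → size (tr α) ≡ ∣ α ∣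
size-tr 𝕗 = refl
size-tr 𝕥 = refl
size-tr (atom true i) = refl
size-tr (atom false i) = refl
size-tr (var true i) = refl
size-tr (var false i) = refl
size-tr (α ∨ β) = cong₂ _+_ (size-tr α) (size-tr β)
size-tr (α ∧ β) = cong₂ _+_ (size-tr α) (size-tr β)

size-pos-CoS : ∀ α → 1 ≤ ∣ α ∣
size-pos-CoS α = subst (1 ≤_) (size-tr α) (size-pos (tr α))

merge-nsize : ∀ k a b Nα Nβ → nsize Nα + 2 ≤ 3 * a → nsize Nβ + 2 ≤ 3 * b →
  nsize (build k (flatten k Nα ⊕ flatten k Nβ)) + 2 ≤ 3 * (a + b)
merge-nsize k a b Nα Nβ α≤ β≤ = begin
  nsize (build k (c ⊕ d)) + 2  ≤⟨ +-monoˡ-≤ 2 (build-nsize k (c ⊕ d)) ⟩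
  fsize (c ⊕ d) + 2            ≡⟨ fsize-⊕ c d ⟩
  fsize c + fsize d            ≤⟨ +-mono-≤ (≤-trans (flatten-fsize k Nα) α≤) (≤-trans (flatten-fsize k Nβ) β≤) ⟩
  3 * a + 3 * b                ≡⟨ *-distribˡ-+ 3 a b ⟨
  3 * (a + b)                  ∎
  where
  open ≤-Reasoning
  c d : Flat
  c = flatten k Nα
  d = flatten k Nβ

nf-nsize : ∀ α → nsize (nf α) + 2 ≤ 3 * ∣ α ∣
nf-nsize 𝕗 = ≤-refl
nf-nsize 𝕥 = ≤-refl
nf-nsize (atom true i) = ≤-refl
nf-nsize (atom false i) = ≤-refl
nf-nsize (var true i) = ≤-refl
nf-nsize (var false i) = ≤-refl
nf-nsize (α ∨ β) = merge-nsize disj ∣ α ∣ ∣ β ∣ (nf α) (nf β) (nf-nsize α) (nf-nsize β)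
nf-nsize (α ∧ β) = merge-nsize conj ∣ α ∣ ∣ β ∣ (nf α) (nf β) (nf-nsize α) (nf-nsize β)

merge-length≤ : ∀ a b → 1 ≤ a → 1 ≤ b →
  2000 * square a + 2000 * square b + 21 + 123 + 5 + 400 * (3 * (a + b)) + 5 + 51 + 5 ≤ 2000 * square (a + b)
merge-length≤ a b 1≤a 1≤b =
  ≤-trans (≤-reflexive (exact a b))
          (≤-trans (+-monoʳ-≤ (2000 * square a + 2000 * square b) (scale-constant 210 1200 (a + b) (≤-trans 1≤a (m≤m+n a b))))
                   (square-superadditive 2000 1410 a b lit≤ 1≤a 1≤b))
  where
  exact : ∀ a b → 2000 * (a * a) + 2000 * (b * b) + 21 + 123 + 5 + 400 * (3 * (a + b)) + 5 + 51 + 5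
                ≡ 2000 * (a * a) + 2000 * (b * b) + (210 + 1200 * (a + b))
  exact = solve-∀

nf-equiv-merge : ∀ k {A B} a b Nα Nβ →
  Equiv (3 * a) (2000 * square a) A (embed Nα) → Equiv (3 * b) (2000 * square b) B (embed Nβ) →
  nsize Nα + 2 ≤ 3 * a → nsize Nβ + 2 ≤ 3 * b → 1 ≤ a → 1 ≤ b →
  Equiv (3 * (a + b)) (2000 * square (a + b)) (op k A B) (embed (build k (flatten k Nα ⊕ flatten k Nβ)))
nf-equiv-merge k {A} {B} a b Nα Nβ A⇔Nα B⇔Nβ α≤ β≤ 1≤a 1≤b =
  equiv-trans (equiv-trans (equiv-trans congruence flattening) merging) building ⟨≤ merge-length≤ a b 1≤a 1≤b
  where
  c d : Flat
  c = flatten k Nα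
  d = flatten k Nβ
  3a+3b : 3 * a + 3 * b ≡ 3 * (a + b)
  3a+3b = sym (*-distribˡ-+ 3 a b)
  c+d≤ : fsize c + fsize d ≤ 3 * (a + b)
  c+d≤ = ≤-trans (+-mono-≤ (≤-trans (flatten-fsize k Nα) α≤) (≤-trans (flatten-fsize k Nβ) β≤)) (≤-reflexive 3a+3b)
  congruence : Equiv (3 * (a + b)) (2000 * square a + 2000 * square b + 21) (op k A B) (op k (embed Nα) (embed Nβ))
  congruence = equiv-size≡ 3a+3b (equiv-cong k A⇔Nα B⇔Nβ)
  flattening : Equiv (3 * (a + b)) (51 + 51 + 21) (op k (embed Nα) (embed Nβ)) (op k (embedFlat k c) (embedFlat k d))
  flattening = equiv-size≤ (≤-trans (+-mono-≤ α≤ β≤) (≤-reflexive 3a+3b)) (equiv-cong k (flatten-equiv k Nα) (flatten-equiv k Nβ))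
  merging : Equiv (3 * (a + b)) (400 * (3 * (a + b))) (op k (embedFlat k c) (embedFlat k d)) (embedFlat k (c ⊕ d))
  merging = equiv-size≤ c+d≤ (merge-equiv k c d) ⟨≤ *-monoʳ-≤ 400 c+d≤
  building : Equiv (3 * (a + b)) 51 (embedFlat k (c ⊕ d)) (embed (build k (c ⊕ d)))
  building = equiv-size≤ (≤-trans (≤-trans (m≤m+n _ 2) (≤-reflexive (fsize-⊕ c d))) c+d≤) (build-equiv k (c ⊕ d))

nf-equiv : ∀ α → Equiv (3 * ∣ α ∣) (2000 * square ∣ α ∣) (tr α) (embed (nf α))
nf-equiv 𝕗 = equiv-weaken lit≤ lit≤ (equiv-refl ≤-refl)
nf-equiv 𝕥 = equiv-weaken lit≤ lit≤ (equiv-refl ≤-refl)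
nf-equiv (atom true i) = equiv-weaken lit≤ lit≤ (equiv-refl ≤-refl)
nf-equiv (atom false i) = equiv-weaken lit≤ lit≤ (equiv-refl ≤-refl)
nf-equiv (var true i) = equiv-weaken lit≤ lit≤ (equiv-refl ≤-refl)
nf-equiv (var false i) = equiv-weaken lit≤ lit≤ (equiv-refl ≤-refl)
nf-equiv (α ∨ β) = nf-equiv-merge disj ∣ α ∣ ∣ β ∣ (nf α) (nf β) (nf-equiv α) (nf-equiv β)
                     (nf-nsize α) (nf-nsize β) (size-pos-CoS α) (size-pos-CoS β)
nf-equiv (α ∧ β) = nf-equiv-merge conj ∣ α ∣ ∣ β ∣ (nf α) (nf β) (nf-equiv α) (nf-equiv β)
                     (nf-nsize α) (nf-nsize β) (size-pos-CoS α) (size-pos-CoS β)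

derivation-from-equiv : ∀ {o ℓ A B} → Equiv o ℓ A B →
  Σ (Derivation A B) λ D → (Derivation.len D ≤ 2 + ℓ) × (Derivation.dsize D ≤ (2 + ℓ) * (K * o))
derivation-from-equiv {o} e = derivation (≤-trans (left≤ e) (m≤n*m o K)) (forth e)

chain-length≤ : ∀ a b s → 1 ≤ a → s ≤ 3 * a →
  2000 * square a + 200 * square s + 5 + 2000 * square b + 5 ≤ 5810 * square (a + b)
chain-length≤ a b s 1≤a s≤3a = begin
  2000 * square a + 200 * square s + 5 + 2000 * square b + 5
    ≤⟨ +-monoˡ-≤ 5 (+-mono-≤ (+-monoˡ-≤ 5 (+-mono-≤ (*-monoʳ-≤ 2000 (*-mono-≤ a≤n a≤n))
                                                    (*-monoʳ-≤ 200 (*-mono-≤ s≤3n s≤3n))))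
                             (*-monoʳ-≤ 2000 (*-mono-≤ b≤n b≤n))) ⟩
  2000 * square n + 200 * square (3 * n) + 5 + 2000 * square n + 5
    ≡⟨ collect n ⟩
  10 + 5800 * square n
    ≤⟨ scale-constant 10 5800 (square n) (*-mono-≤ 1≤n 1≤n) ⟩
  5810 * square n ∎
  where
  open ≤-Reasoning
  n : ℕ
  n = a + b
  a≤n : a ≤ n
  a≤n = m≤m+n a b
  b≤n : b ≤ n
  b≤n = m≤n+m b a
  s≤3n : s ≤ 3 * n
  s≤3n = ≤-trans s≤3a (*-monoʳ-≤ 3 a≤n)
  1≤n : 1 ≤ n
  1≤n = ≤-trans 1≤a a≤n
  collect : ∀ n → 2000 * (n * n) + 200 * (3 * n * (3 * n)) + 5 + 2000 * (n * n) + 5 ≡ 10 + 5800 * (n * n)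
  collect = solve-∀

equal-equiv : ∀ {α β} → α ≐ β → Equiv (3 * (∣ α ∣ + ∣ β ∣)) (5810 * square (∣ α ∣ + ∣ β ∣)) (tr α) (tr β)
equal-equiv {α} {β} α≐β =
  equiv-trans (equiv-trans (equiv-size≤ (*-monoʳ-≤ 3 a≤n) (nf-equiv α))
                           (equiv-size≤ (≤-trans s≤3a (*-monoʳ-≤ 3 a≤n)) (≈-equiv (nf-respects α≐β))))
              (equiv-size≤ (*-monoʳ-≤ 3 (m≤n+m ∣ β ∣ ∣ α ∣)) (equiv-sym (nf-equiv β)))
  ⟨≤ chain-length≤ ∣ α ∣ ∣ β ∣ (nsize (nf α)) (size-pos-CoS α) s≤3a
  where
  a≤n : ∣ α ∣ ≤ ∣ α ∣ + ∣ β ∣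
  a≤n = m≤m+n ∣ α ∣ ∣ β ∣
  s≤3a : nsize (nf α) ≤ 3 * ∣ α ∣
  s≤3a = ≤-trans (m≤m+n (nsize (nf α)) 2) (nf-nsize α)

≤-*-pos : ∀ {n} m → 1 ≤ n → m ≤ n * m
≤-*-pos m 1≤n = ≤-trans (≤-reflexive (sym (*-identityˡ m))) (*-monoˡ-≤ m 1≤n)

square≤cube : ∀ n → 1 ≤ n → square n ≤ n ^ 3
square≤cube n 1≤n = *-monoʳ-≤ n (≤-trans (≤-reflexive (sym (*-identityʳ n))) (≤-*-pos (n * 1) 1≤n))

cube≤quartic : ∀ n → 1 ≤ n → n * square n ≤ n ^ 4
cube≤quartic n 1≤n = *-monoʳ-≤ n (square≤cube n 1≤n)

-- The resulting polynomial bounds (in fact O(n²) lines and O(n³) size).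
length-bound : ∀ c n → 1 ≤ n → 2 + c * square n ≤ (2 + c) * n ^ 3
length-bound c n 1≤n = begin
  2 + c * square n    ≤⟨ scale-constant 2 c (square n) (*-mono-≤ 1≤n 1≤n) ⟩
  (2 + c) * square n  ≤⟨ *-monoʳ-≤ (2 + c) (square≤cube n 1≤n) ⟩
  (2 + c) * n ^ 3     ∎
  where open ≤-Reasoning

size-bound : ∀ c n → 1 ≤ n → (2 + c * square n) * (K * (3 * n)) ≤ (2 + c) * 48 * n ^ 4
size-bound c n 1≤n = begin
  (2 + c * square n) * (K * (3 * n))  ≤⟨ *-monoˡ-≤ (K * (3 * n)) (scale-constant 2 c (square n) (*-mono-≤ 1≤n 1≤n)) ⟩
  (2 + c) * square n * (K * (3 * n))  ≡⟨ regroup (2 + c) n ⟩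
  (2 + c) * 48 * (n * square n)       ≤⟨ *-monoʳ-≤ ((2 + c) * 48) (cube≤quartic n 1≤n) ⟩
  (2 + c) * 48 * n ^ 4                ∎
  where
  open ≤-Reasoning
  regroup : ∀ d n → d * (n * n) * (16 * (3 * n)) ≡ d * 48 * (n * (n * n))
  regroup = solve-∀

-- The constants are written as 2 + 5810 so that they match
-- length-bound and size-bound syntactically, without unfolding numerals.
lemma4p9 : Σ ℕ λ c₁ → Σ ℕ λ c₂ →
    ∀ (α β : CoS) → α ≐ β →
    Σ (Derivation (tr α) (tr β)) λ d →
    (Derivation.len d ≤ c₁ * (∣ α ∣ + ∣ β ∣) ^ 3) ×
    (Derivation.dsize d ≤ c₂ * (∣ α ∣ + ∣ β ∣) ^ 4)
lemma4p9 = 2 + 5810 , (2 + 5810) * 48 , theorem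
  where
  theorem : ∀ (α β : CoS) → α ≐ β →
    Σ (Derivation (tr α) (tr β)) λ d →
    (Derivation.len d ≤ (2 + 5810) * (∣ α ∣ + ∣ β ∣) ^ 3) × (Derivation.dsize d ≤ (2 + 5810) * 48 * (∣ α ∣ + ∣ β ∣) ^ 4)
  theorem α β α≐β =
    Product.map₂ (Product.map (λ len≤ → ≤-trans len≤ (length-bound 5810 (∣ α ∣ + ∣ β ∣) 1≤n))
                              (λ dsize≤ → ≤-trans dsize≤ (size-bound 5810 (∣ α ∣ + ∣ β ∣) 1≤n)))
                 (derivation-from-equiv (equal-equiv α≐β))
    where
    1≤n : 1 ≤ ∣ α ∣ + ∣ β ∣
    1≤n = ≤-trans (size-pos-CoS α) (m≤m+n ∣ α ∣ ∣ β ∣)
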